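{- Let $\mathcal{C}$ be a Kleene rig category, and let $f\colon S\oplus X\to S\oplus Y$ and $f'\colon S'\oplus X'\to S'\oplus Y'$ have matrix components $f_{SS},f_{SY},f_{XS},f_{XY}$ and $f'_{S'S'},f'_{S'Y'},f'_{X'S'},f'_{X'Y'}$ respectively. Then $$\mathsf{tr}_{S\otimes S'}\begin{pmatrix} f_{SS}\otimes f'_{S'S'} & f_{SY}\otimes f'_{S'Y'}\\ f_{XS}\otimes f'_{X'S'} & f_{XY}\otimes f'_{X'Y'}\end{pmatrix}\ \le\ \mathsf{tr}_S f\otimes\mathsf{tr}_{S'}f',$$ where the matrix denotes a morphism $(S\otimes S')\oplus(X\otimes X')\to(S\otimes S')\oplus(Y\otimes Y')$.
   Context: Composition is diagrammatic. A Kleene rig category is a poset-enriched rig category (two symmetric monoidal structures $(\otimes,1)$, $(\oplus,0)$ with distributors and annihilators satisfying Laplaza's axioms; $;$, $\oplus$, $\otimes$ monotone) such that $(\mathcal{C},\oplus,0)$ is a Kleene bicategory: finite biproducts via monoids $(\nabla_X,¡_X)$ and comonoids $(\Delta_X,!_X)$ (every morphism a homomorphism), with $\mathrm{id}_{X\oplus X}\le\nabla_X;\Delta_X$, $\Delta_X;\nabla_X\le\mathrm{id}_X$, $\mathrm{id}_0\le¡_X;!_X$, $!_X;¡_X\le\mathrm{id}_X$, and a trace $\mathsf{tr}_S\colon\mathcal{C}(S\oplus X,S\oplus Y)\to\mathcal{C}(X,Y)$ (tightening, strength, joining, vanishing, sliding, yanking) satisfying (AU1) $f;(r\oplus\mathrm{id})\le(r\oplus\mathrm{id});g$,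 $r\colon S\to T$, implies $\mathsf{tr}_Sf\le\mathsf{tr}_Tg$; (AU2) $(r\oplus\mathrm{id});f\le g;(r\oplus\mathrm{id})$, $r\colon T\to S$, implies $\mathsf{tr}_Sf\le\mathsf{tr}_Tg$; (AT1) $\mathsf{tr}_X(\nabla_X;\Delta_X)\le\mathrm{id}_X$. For $a\colon S\to T$, $b\colon S\to Y$, $c\colon X\to T$, $d\colon X\to Y$, the matrix $\begin{pmatrix}a&b\\c&d\end{pmatrix}\colon S\oplus X\to T\oplus Y$ denotes $(\Delta_S\oplus\Delta_X);(a\oplus b\oplus c\oplus d);(\mathrm{id}_T\oplus\sigma^{\oplus}_{Y,T}\oplus\mathrm{id}_Y);(\nabla_T\oplus\nabla_Y)$. The components of $f\colon S\oplus X\to T\oplus Y$ are $f_{ST}=(\mathrm{id}_S\oplus¡_X);f;(\mathrm{id}_T\oplus!_Y)$, $f_{SY}=(\mathrm{id}_S\oplus¡_X);f;(!_T\oplus\mathrm{id}_Y)$, $f_{XT}=(¡_S\oplus\mathrm{id}_X);f;(\mathrm{id}_T\oplus!_Y)$, $f_{XY}=(¡_S\oplus\mathrm{id}_X);f;(!_T\oplus\mathrm{id}_Y)$, and $f$ equals the matrix of its components. -}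

module Defs where

-- Kleene rig categories (poset-enriched rig categories whose additive part is
-- a Kleene bicategory).  Composition is diagrammatic and written _⨾_.

open import Level using (Level; _⊔_) renaming (suc to lsuc)
open import Data.Product using (_×_; _,_)

record RawCategory (o h r : Level) : Set (lsuc (o ⊔ h ⊔ r)) where
  infixr 5 _⨾_
  infix 4 _≤_ _≈_
  field
    Obj : Set o
    _⇒_ : Obj → Obj → Set h
    id  : ∀ {A} → A ⇒ A
    _⨾_ : ∀ {A B C} → A ⇒ B → B ⇒ C → A ⇒ C
    _≤_ : ∀ {A B} → A ⇒ B → A ⇒ B → Set r

  _≈_ : ∀ {A B} → A ⇒ B → A ⇒ B → Set r
  f ≈ g = (f ≤ g) × (g ≤ f)

module _ {o h r : Level} (C : RawCategory o h r) where
  open RawCategory C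

  record IsPosetCategory : Set (o ⊔ h ⊔ r) where
    field
      ≤-refl  : ∀ {A B} {f : A ⇒ B} → f ≤ f
      ≤-trans : ∀ {A B} {f g k : A ⇒ B} → f ≤ g → g ≤ k → f ≤ k
      ⨾-mono  : ∀ {A B D} {f f′ : A ⇒ B} {g g′ : B ⇒ D} →
                f ≤ f′ → g ≤ g′ → (f ⨾ g) ≤ (f′ ⨾ g′)
      identityˡ : ∀ {A B} {f : A ⇒ B} → (id ⨾ f) ≈ f
      identityʳ : ∀ {A B} {f : A ⇒ B} → (f ⨾ id) ≈ f
      assoc     : ∀ {A B D E} {f : A ⇒ B} {g : B ⇒ D} {k : D ⇒ E} →
                  ((f ⨾ g) ⨾ k) ≈ (f ⨾ (g ⨾ k))

  record IsSymmetricMonoidal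
    (_●_ : Obj → Obj → Obj) (I : Obj)
    (_●₁_ : ∀ {A B D E} → A ⇒ B → D ⇒ E → (A ● D) ⇒ (B ● E))
    (α  : ∀ {A B D} → ((A ● B) ● D) ⇒ (A ● (B ● D)))
    (α⁻ : ∀ {A B D} → (A ● (B ● D)) ⇒ ((A ● B) ● D))
    (l  : ∀ {A} → (I ● A) ⇒ A)
    (l⁻ : ∀ {A} → A ⇒ (I ● A))
    (ρ  : ∀ {A} → (A ● I) ⇒ A)
    (ρ⁻ : ∀ {A} → A ⇒ (A ● I))
    (σ  : ∀ {A B} → (A ● B) ⇒ (B ● A))
    : Set (o ⊔ h ⊔ r) where
    field
      ●-mono : ∀ {A B D E} {f f′ : A ⇒ B} {g g′ : D ⇒ E} →
               f ≤ f′ → g ≤ g′ → (f ●₁ g) ≤ (f′ ●₁ g′)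
      ●-id   : ∀ {A B} → (id {A} ●₁ id {B}) ≈ id
      ●-hom  : ∀ {A B D A′ B′ D′} {f : A ⇒ B} {g : B ⇒ D} {f′ : A′ ⇒ B′} {g′ : B′ ⇒ D′} →
               ((f ⨾ g) ●₁ (f′ ⨾ g′)) ≈ ((f ●₁ f′) ⨾ (g ●₁ g′))
      α-nat  : ∀ {A B D A′ B′ D′} {f : A ⇒ A′} {g : B ⇒ B′} {k : D ⇒ D′} →
               (((f ●₁ g) ●₁ k) ⨾ α) ≈ (α ⨾ (f ●₁ (g ●₁ k)))
      α-isoˡ : ∀ {A B D} → (α {A} {B} {D} ⨾ α⁻) ≈ id
      α-isoʳ : ∀ {A B D} → (α⁻ {A} {B} {D} ⨾ α) ≈ id
      l-nat  : ∀ {A B} {f : A ⇒ B} → ((id {I} ●₁ f) ⨾ l) ≈ (l ⨾ f)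
      l-isoˡ : ∀ {A} → (l {A} ⨾ l⁻) ≈ id
      l-isoʳ : ∀ {A} → (l⁻ {A} ⨾ l) ≈ id
      ρ-nat  : ∀ {A B} {f : A ⇒ B} → ((f ●₁ id {I}) ⨾ ρ) ≈ (ρ ⨾ f)
      ρ-isoˡ : ∀ {A} → (ρ {A} ⨾ ρ⁻) ≈ id
      ρ-isoʳ : ∀ {A} → (ρ⁻ {A} ⨾ ρ) ≈ id
      σ-nat  : ∀ {A B D E} {f : A ⇒ B} {g : D ⇒ E} →
               ((f ●₁ g) ⨾ σ) ≈ (σ ⨾ (g ●₁ f))
      σ-inv  : ∀ {A B} → (σ {A} {B} ⨾ σ) ≈ id
      pentagon : ∀ {A B D E} →
               ((α {A} {B} {D} ●₁ id {E}) ⨾ α ⨾ (id ●₁ α)) ≈ (α ⨾ α)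
      triangle : ∀ {A B} → (α {A} {I} {B} ⨾ (id ●₁ l)) ≈ (ρ ●₁ id)
      hexagon  : ∀ {A B D} →
               (α {A} {B} {D} ⨾ σ ⨾ α) ≈ ((σ ●₁ id) ⨾ α ⨾ (id ●₁ σ))

record RawKleeneRig (o h r : Level) : Set (lsuc (o ⊔ h ⊔ r)) where
  field
    cat : RawCategory o h r
  open RawCategory cat public
  infixr 7 _⊗₀_ _⊗₁_
  infixr 6 _⊕₀_ _⊕₁_
  field
    _⊗₀_ : Obj → Obj → Obj
    𝟙    : Obj
    _⊗₁_ : ∀ {A B D E} → A ⇒ B → D ⇒ E → (A ⊗₀ D) ⇒ (B ⊗₀ E)
    α⊗   : ∀ {A B D} → ((A ⊗₀ B) ⊗₀ D) ⇒ (A ⊗₀ (B ⊗₀ D))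
    α⊗⁻¹ : ∀ {A B D} → (A ⊗₀ (B ⊗₀ D)) ⇒ ((A ⊗₀ B) ⊗₀ D)
    lu⊗   : ∀ {A} → (𝟙 ⊗₀ A) ⇒ A
    lu⊗⁻¹ : ∀ {A} → A ⇒ (𝟙 ⊗₀ A)
    ru⊗   : ∀ {A} → (A ⊗₀ 𝟙) ⇒ A
    ru⊗⁻¹ : ∀ {A} → A ⇒ (A ⊗₀ 𝟙)
    σ⊗   : ∀ {A B} → (A ⊗₀ B) ⇒ (B ⊗₀ A)
    _⊕₀_ : Obj → Obj → Obj
    𝟘    : Obj
    _⊕₁_ : ∀ {A B D E} → A ⇒ B → D ⇒ E → (A ⊕₀ D) ⇒ (B ⊕₀ E)
    α⊕   : ∀ {A B D} → ((A ⊕₀ B) ⊕₀ D) ⇒ (A ⊕₀ (B ⊕₀ D))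
    α⊕⁻¹ : ∀ {A B D} → (A ⊕₀ (B ⊕₀ D)) ⇒ ((A ⊕₀ B) ⊕₀ D)
    lu⊕   : ∀ {A} → (𝟘 ⊕₀ A) ⇒ A
    lu⊕⁻¹ : ∀ {A} → A ⇒ (𝟘 ⊕₀ A)
    ru⊕   : ∀ {A} → (A ⊕₀ 𝟘) ⇒ A
    ru⊕⁻¹ : ∀ {A} → A ⇒ (A ⊕₀ 𝟘)
    σ⊕   : ∀ {A B} → (A ⊕₀ B) ⇒ (B ⊕₀ A)
    δˡ   : ∀ {A B D} → (A ⊗₀ (B ⊕₀ D)) ⇒ ((A ⊗₀ B) ⊕₀ (A ⊗₀ D))
    δˡ⁻¹ : ∀ {A B D} → ((A ⊗₀ B) ⊕₀ (A ⊗₀ D)) ⇒ (A ⊗₀ (B ⊕₀ D))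
    δʳ   : ∀ {A B D} → ((A ⊕₀ B) ⊗₀ D) ⇒ ((A ⊗₀ D) ⊕₀ (B ⊗₀ D))
    δʳ⁻¹ : ∀ {A B D} → ((A ⊗₀ D) ⊕₀ (B ⊗₀ D)) ⇒ ((A ⊕₀ B) ⊗₀ D)
    λ*   : ∀ {A} → (𝟘 ⊗₀ A) ⇒ 𝟘
    λ*⁻¹ : ∀ {A} → 𝟘 ⇒ (𝟘 ⊗₀ A)
    ρ*   : ∀ {A} → (A ⊗₀ 𝟘) ⇒ 𝟘
    ρ*⁻¹ : ∀ {A} → 𝟘 ⇒ (A ⊗₀ 𝟘)
    ∇  : ∀ {A} → (A ⊕₀ A) ⇒ A
    ¡  : ∀ {A} → 𝟘 ⇒ A
    Δ  : ∀ {A} → A ⇒ (A ⊕₀ A)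
    !  : ∀ {A} → A ⇒ 𝟘
    tr : ∀ {S A B} → (S ⊕₀ A) ⇒ (S ⊕₀ B) → A ⇒ B

  shuffle : ∀ {A B D E} → ((A ⊕₀ B) ⊕₀ (D ⊕₀ E)) ⇒ ((A ⊕₀ D) ⊕₀ (B ⊕₀ E))
  shuffle = α⊕ ⨾ (id ⊕₁ α⊕⁻¹) ⨾ (id ⊕₁ (σ⊕ ⊕₁ id)) ⨾ (id ⊕₁ α⊕) ⨾ α⊕⁻¹

record IsKleeneRig {o h r : Level} (K : RawKleeneRig o h r) : Set (o ⊔ h ⊔ r) where
  open RawKleeneRig K
  field
    isPosetCategory : IsPosetCategory cat
    ⊗-symmetric : IsSymmetricMonoidal cat _⊗₀_ 𝟙 _⊗₁_ α⊗ α⊗⁻¹ lu⊗ lu⊗⁻¹ ru⊗ ru⊗⁻¹ σ⊗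
    ⊕-symmetric : IsSymmetricMonoidal cat _⊕₀_ 𝟘 _⊕₁_ α⊕ α⊕⁻¹ lu⊕ lu⊕⁻¹ ru⊕ ru⊕⁻¹ σ⊕

    δˡ-nat  : ∀ {A B D A′ B′ D′} {f : A ⇒ A′} {g : B ⇒ B′} {k : D ⇒ D′} →
              ((f ⊗₁ (g ⊕₁ k)) ⨾ δˡ) ≈ (δˡ ⨾ ((f ⊗₁ g) ⊕₁ (f ⊗₁ k)))
    δˡ-isoˡ : ∀ {A B D} → (δˡ {A} {B} {D} ⨾ δˡ⁻¹) ≈ id
    δˡ-isoʳ : ∀ {A B D} → (δˡ⁻¹ {A} {B} {D} ⨾ δˡ) ≈ id
    δʳ-nat  : ∀ {A B D A′ B′ D′} {f : A ⇒ A′} {g : B ⇒ B′} {k : D ⇒ D′} →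
              (((f ⊕₁ g) ⊗₁ k) ⨾ δʳ) ≈ (δʳ ⨾ ((f ⊗₁ k) ⊕₁ (g ⊗₁ k)))
    δʳ-isoˡ : ∀ {A B D} → (δʳ {A} {B} {D} ⨾ δʳ⁻¹) ≈ id
    δʳ-isoʳ : ∀ {A B D} → (δʳ⁻¹ {A} {B} {D} ⨾ δʳ) ≈ id
    λ*-nat  : ∀ {A B} {f : A ⇒ B} → ((id {𝟘} ⊗₁ f) ⨾ λ*) ≈ λ*
    λ*-isoˡ : ∀ {A} → (λ* {A} ⨾ λ*⁻¹) ≈ id
    λ*-isoʳ : ∀ {A} → (λ*⁻¹ {A} ⨾ λ*) ≈ id
    ρ*-nat  : ∀ {A B} {f : A ⇒ B} → ((f ⊗₁ id {𝟘}) ⨾ ρ*) ≈ ρ*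
    ρ*-isoˡ : ∀ {A} → (ρ* {A} ⨾ ρ*⁻¹) ≈ id
    ρ*-isoʳ : ∀ {A} → (ρ*⁻¹ {A} ⨾ ρ*) ≈ id

    -- Laplaza's coherence axioms (numbering after Laplaza; α⊕, α⊗ point rightwards)
    lap-I    : ∀ {A B D} → (δˡ {A} {B} {D} ⨾ σ⊕) ≈ ((id ⊗₁ σ⊕) ⨾ δˡ)
    lap-II   : ∀ {A B D} → (δʳ {A} {B} {D} ⨾ σ⊕) ≈ ((σ⊕ ⊗₁ id) ⨾ δʳ)
    lap-III  : ∀ {A B D} → (σ⊗ ⨾ δˡ ⨾ (σ⊗ ⊕₁ σ⊗)) ≈ δʳ {A} {B} {D}
    lap-IV   : ∀ {A B D E} →
               (δˡ {A} {B ⊕₀ D} {E} ⨾ (δˡ ⊕₁ id) ⨾ α⊕) ≈ ((id ⊗₁ α⊕) ⨾ δˡ ⨾ (id ⊕₁ δˡ))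
    lap-V    : ∀ {A B D E} →
               (δʳ {A ⊕₀ B} {D} {E} ⨾ (δʳ ⊕₁ id) ⨾ α⊕) ≈ ((α⊕ ⊗₁ id) ⨾ δʳ ⨾ (id ⊕₁ δʳ))
    lap-VI   : ∀ {A B D E} →
               (α⊗ {A} {B} {D ⊕₀ E} ⨾ (id ⊗₁ δˡ) ⨾ δˡ) ≈ (δˡ ⨾ (α⊗ ⊕₁ α⊗))
    lap-VII  : ∀ {A B D E} →
               (α⊗ {A} {B ⊕₀ D} {E} ⨾ (id ⊗₁ δʳ) ⨾ δˡ) ≈ ((δˡ ⊗₁ id) ⨾ δʳ ⨾ (α⊗ ⊕₁ α⊗))
    lap-VIII : ∀ {A B D E} →
               (α⊗ {A ⊕₀ B} {D} {E} ⨾ δʳ) ≈ ((δʳ ⊗₁ id) ⨾ δʳ ⨾ (α⊗ ⊕₁ α⊗))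
    lap-IX   : ∀ {A B D E} →
               (δʳ {A} {B} {D ⊕₀ E} ⨾ (δˡ ⊕₁ δˡ) ⨾ shuffle) ≈ (δˡ ⨾ (δʳ ⊕₁ δʳ))
    lap-X    : λ* {𝟘} ≈ ρ* {𝟘}
    lap-XI   : ∀ {A B} → (α⊗ {𝟘} {A} {B} ⨾ λ*) ≈ ((λ* ⊗₁ id) ⨾ λ*)
    lap-XII  : ∀ {A B} → (α⊗ {A} {B} {𝟘} ⨾ (id ⊗₁ ρ*) ⨾ ρ*) ≈ ρ*
    lap-XIII : ∀ {A B} → ((ρ* {A} ⊗₁ id {B}) ⨾ λ*) ≈ (α⊗ ⨾ (id ⊗₁ λ*) ⨾ ρ*)
    lap-XIV  : ∀ {A B} → (δˡ {A} {𝟘} {B} ⨾ (ρ* ⊕₁ id) ⨾ lu⊕) ≈ (id ⊗₁ lu⊕)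
    lap-XIV′ : ∀ {A B} → (δˡ {A} {B} {𝟘} ⨾ (id ⊕₁ ρ*) ⨾ ru⊕) ≈ (id ⊗₁ ru⊕)
    lap-XV   : ∀ {A B} → (δʳ {𝟘} {A} {B} ⨾ (λ* ⊕₁ id) ⨾ lu⊕) ≈ (lu⊕ ⊗₁ id)
    lap-XV′  : ∀ {A B} → (δʳ {A} {𝟘} {B} ⨾ (id ⊕₁ λ*) ⨾ ru⊕) ≈ (ru⊕ ⊗₁ id)
    lap-XVI  : ∀ {A} → (σ⊗ ⨾ λ*) ≈ ρ* {A}
    lap-XVII : ∀ {A B} → (δˡ {𝟘} {A} {B} ⨾ (λ* ⊕₁ λ*) ⨾ lu⊕) ≈ λ*
    lap-XVIII : ∀ {A B} → (δʳ {A} {B} {𝟘} ⨾ (ρ* ⊕₁ ρ*) ⨾ lu⊕) ≈ ρ*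
    lap-XIX  : lu⊗ {𝟘} ≈ ρ* {𝟙}
    lap-XX   : ru⊗ {𝟘} ≈ λ* {𝟙}
    lap-XXI  : ∀ {A B} → (δˡ {𝟙} {A} {B} ⨾ (lu⊗ ⊕₁ lu⊗)) ≈ lu⊗
    lap-XXII : ∀ {A B} → (δʳ {A} {B} {𝟙} ⨾ (ru⊗ ⊕₁ ru⊗)) ≈ ru⊗

    Δ-coassoc : ∀ {A} → (Δ {A} ⨾ (Δ ⊕₁ id) ⨾ α⊕) ≈ (Δ ⨾ (id ⊕₁ Δ))
    Δ-counitˡ : ∀ {A} → (Δ {A} ⨾ (! ⊕₁ id) ⨾ lu⊕) ≈ id
    Δ-counitʳ : ∀ {A} → (Δ {A} ⨾ (id ⊕₁ !) ⨾ ru⊕) ≈ id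
    Δ-comm    : ∀ {A} → (Δ {A} ⨾ σ⊕) ≈ Δ
    ∇-assoc   : ∀ {A} → ((∇ {A} ⊕₁ id) ⨾ ∇) ≈ (α⊕ ⨾ (id ⊕₁ ∇) ⨾ ∇)
    ∇-unitˡ   : ∀ {A} → (lu⊕⁻¹ ⨾ (¡ ⊕₁ id) ⨾ ∇) ≈ id {A}
    ∇-unitʳ   : ∀ {A} → (ru⊕⁻¹ ⨾ (id ⊕₁ ¡) ⨾ ∇) ≈ id {A}
    ∇-comm    : ∀ {A} → (σ⊕ ⨾ ∇) ≈ ∇ {A}
    Δ-⊕ : ∀ {A B} → Δ {A ⊕₀ B} ≈ ((Δ ⊕₁ Δ) ⨾ shuffle)
    Δ-𝟘 : Δ {𝟘} ≈ lu⊕⁻¹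
    !-⊕ : ∀ {A B} → ! {A ⊕₀ B} ≈ ((! ⊕₁ !) ⨾ lu⊕)
    !-𝟘 : ! {𝟘} ≈ id
    ∇-⊕ : ∀ {A B} → ∇ {A ⊕₀ B} ≈ (shuffle ⨾ (∇ ⊕₁ ∇))
    ∇-𝟘 : ∇ {𝟘} ≈ lu⊕
    ¡-⊕ : ∀ {A B} → ¡ {A ⊕₀ B} ≈ (lu⊕⁻¹ ⨾ (¡ ⊕₁ ¡))
    ¡-𝟘 : ¡ {𝟘} ≈ id
    Δ-nat : ∀ {A B} {f : A ⇒ B} → (f ⨾ Δ) ≈ (Δ ⨾ (f ⊕₁ f))
    !-nat : ∀ {A B} {f : A ⇒ B} → (f ⨾ !) ≈ !
    ∇-nat : ∀ {A B} {f : A ⇒ B} → (∇ ⨾ f) ≈ ((f ⊕₁ f) ⨾ ∇)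
    ¡-nat : ∀ {A B} {f : A ⇒ B} → (¡ ⨾ f) ≈ ¡
    ∇Δ-ineq : ∀ {A} → id {A ⊕₀ A} ≤ (∇ ⨾ Δ)
    Δ∇-ineq : ∀ {A} → (Δ ⨾ ∇) ≤ id {A}
    ¡!-ineq : ∀ {A} → id {𝟘} ≤ (¡ {A} ⨾ !)
    !¡-ineq : ∀ {A} → (! ⨾ ¡) ≤ id {A}

    tr-tightening : ∀ {S A A′ B B′} {g : A′ ⇒ A} {f : (S ⊕₀ A) ⇒ (S ⊕₀ B)} {k : B ⇒ B′} →
                    tr ((id ⊕₁ g) ⨾ f ⨾ (id ⊕₁ k)) ≈ (g ⨾ tr f ⨾ k)
    tr-strength   : ∀ {S A B D E} {f : (S ⊕₀ A) ⇒ (S ⊕₀ B)} {g : D ⇒ E} →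
                    tr {S} (α⊕⁻¹ ⨾ (f ⊕₁ g) ⨾ α⊕) ≈ (tr f ⊕₁ g)
    tr-joining    : ∀ {S T A B} {f : ((S ⊕₀ T) ⊕₀ A) ⇒ ((S ⊕₀ T) ⊕₀ B)} →
                    tr {S ⊕₀ T} f ≈ tr {T} (tr {S} (α⊕⁻¹ ⨾ f ⨾ α⊕))
    tr-vanishing  : ∀ {A B} {f : (𝟘 ⊕₀ A) ⇒ (𝟘 ⊕₀ B)} →
                    tr {𝟘} f ≈ (lu⊕⁻¹ ⨾ f ⨾ lu⊕)
    tr-sliding    : ∀ {S T A B} {f : (S ⊕₀ A) ⇒ (T ⊕₀ B)} {g : T ⇒ S} →
                    tr {S} (f ⨾ (g ⊕₁ id)) ≈ tr {T} ((g ⊕₁ id) ⨾ f)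
    tr-yanking    : ∀ {A} → tr {A} σ⊕ ≈ id
    AU1 : ∀ {S T A B} {r : S ⇒ T} {f : (S ⊕₀ A) ⇒ (S ⊕₀ B)} {g : (T ⊕₀ A) ⇒ (T ⊕₀ B)} →
          (f ⨾ (r ⊕₁ id)) ≤ ((r ⊕₁ id) ⨾ g) → tr f ≤ tr g
    AU2 : ∀ {S T A B} {r : T ⇒ S} {f : (S ⊕₀ A) ⇒ (S ⊕₀ B)} {g : (T ⊕₀ A) ⇒ (T ⊕₀ B)} →
          ((r ⊕₁ id) ⨾ f) ≤ (g ⨾ (r ⊕₁ id)) → tr f ≤ tr g
    AT1 : ∀ {A} → tr {A} (∇ ⨾ Δ) ≤ id

record KleeneRigCategory (o h r : Level) : Set (lsuc (o ⊔ h ⊔ r)) where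
  field
    raw         : RawKleeneRig o h r
    isKleeneRig : IsKleeneRig raw
  open RawKleeneRig raw public
  open IsKleeneRig isKleeneRig public

module Matrix {o h r : Level} (K : KleeneRigCategory o h r) where
  open KleeneRigCategory K

  -- ( a b ; c d ) : S ⊕ X → T ⊕ Y
  matrix : ∀ {S X T Y} → S ⇒ T → S ⇒ Y → X ⇒ T → X ⇒ Y → (S ⊕₀ X) ⇒ (T ⊕₀ Y)
  matrix a b c d = (Δ ⊕₁ Δ) ⨾ ((a ⊕₁ b) ⊕₁ (c ⊕₁ d)) ⨾ shuffle ⨾ (∇ ⊕₁ ∇)

  module _ {S X T Y} (f : (S ⊕₀ X) ⇒ (T ⊕₀ Y)) where
    comp-ST : S ⇒ T
    comp-ST = ru⊕⁻¹ ⨾ (id ⊕₁ ¡) ⨾ f ⨾ (id ⊕₁ !) ⨾ ru⊕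
    comp-SY : S ⇒ Y
    comp-SY = ru⊕⁻¹ ⨾ (id ⊕₁ ¡) ⨾ f ⨾ (! ⊕₁ id) ⨾ lu⊕
    comp-XT : X ⇒ T
    comp-XT = lu⊕⁻¹ ⨾ (¡ ⊕₁ id) ⨾ f ⨾ (id ⊕₁ !) ⨾ ru⊕
    comp-XY : X ⇒ Y
    comp-XY = lu⊕⁻¹ ⨾ (¡ ⊕₁ id) ⨾ f ⨾ (! ⊕₁ id) ⨾ lu⊕

{-# OPTIONS --safe #-}
module Submission where

open import Level using (Level)
open import Data.Product using (_,_; proj₁; proj₂)
open import Relation.Binary.Bundles using (Poset)
import Relation.Binary.Reasoning.PartialOrder as PosetReasoning
open import Defs

-- Let u = f_SS* ⨾ f_SY be the trace of f entered through its state wire.  Then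
--   f_SS ⨾ u ≤ u,   f_SY ≤ u,   f_XS ⨾ u ≤ tr f,   f_XY ≤ tr f,
-- and since ⊗ is a monotone functor the same four inequalities hold for the tensored
-- components with u ⊗ u′ and tr f ⊗ tr f′.  Inequalities a ⨾ u ≤ u, b ≤ u, c ⨾ u ≤ z,
-- d ≤ z bound the trace of the matrix ( a b ; c d ) by z: by uniformity (AU1) along u
-- the matrix may be replaced by (u ⊕ z) ⨾ ∇ ⨾ Δ, which ignores its state, and AT1
-- removes the trace.
-- Only f_XS ⨾ u ≤ tr f needs an idea: duplicate the state, let X enter the first copy
-- through f_XS and run the loop of u on both copies.  Merging the copies with ∇ (AU1)
-- bounds this by tr f, while tracing out the first copy alone (joining) exposes f_XS ⨾ u.

module KleeneRigProperties {o h r : Level} (K : KleeneRigCategory o h r) where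
  open KleeneRigCategory K
  open Matrix K
  open IsPosetCategory isPosetCategory

  module ⊕ = IsSymmetricMonoidal ⊕-symmetric
  module ⊗ = IsSymmetricMonoidal ⊗-symmetric

  private
    variable
      A B C D E A′ B′ C′ D′ S X Y : Obj

  ≈-refl : {f : A ⇒ B} → f ≈ f
  ≈-refl = ≤-refl , ≤-refl

  ≈-sym : {f g : A ⇒ B} → f ≈ g → g ≈ f
  ≈-sym (f≤g , g≤f) = g≤f , f≤g

  ≈-trans : {f g k : A ⇒ B} → f ≈ g → g ≈ k → f ≈ k
  ≈-trans (f≤g , g≤f) (g≤k , k≤g) = ≤-trans f≤g g≤k , ≤-trans k≤g g≤f

  ≈⇒≤ : {f g : A ⇒ B} → f ≈ g → f ≤ g
  ≈⇒≤ = proj₁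

  ≈⇒≥ : {f g : A ⇒ B} → f ≈ g → g ≤ f
  ≈⇒≥ = proj₂

  homPoset : Obj → Obj → Poset h r r
  homPoset A B = record
    { Carrier        = A ⇒ B
    ; _≈_            = _≈_
    ; _≤_            = _≤_
    ; isPartialOrder = record
      { isPreorder = record
        { isEquivalence = record { refl = ≈-refl ; sym = ≈-sym ; trans = ≈-trans }
        ; reflexive     = ≈⇒≤
        ; trans         = ≤-trans
        }
      ; antisym = _,_
      }
    }

  module HomReasoning {A B : Obj} = PosetReasoning (homPoset A B)

  infixr 4 _⟩⨾⟨_

  _⟩⨾⟨_ : {f f′ : A ⇒ B} {g g′ : B ⇒ C} → f ≈ f′ → g ≈ g′ → (f ⨾ g) ≈ (f′ ⨾ g′)
  (p , q) ⟩⨾⟨ (p′ , q′) = ⨾-mono p p′ , ⨾-mono q q′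

  refl⟩⨾⟨_ : {f : A ⇒ B} {g g′ : B ⇒ C} → g ≈ g′ → (f ⨾ g) ≈ (f ⨾ g′)
  refl⟩⨾⟨ p = ≈-refl ⟩⨾⟨ p

  _⟩⨾⟨refl : {f f′ : A ⇒ B} {g : B ⇒ C} → f ≈ f′ → (f ⨾ g) ≈ (f′ ⨾ g)
  p ⟩⨾⟨refl = p ⟩⨾⟨ ≈-refl

  ⨾-monoˡ : {f f′ : A ⇒ B} {g : B ⇒ C} → f ≤ f′ → (f ⨾ g) ≤ (f′ ⨾ g)
  ⨾-monoˡ p = ⨾-mono p ≤-refl

  ⨾-monoʳ : {f : A ⇒ B} {g g′ : B ⇒ C} → g ≤ g′ → (f ⨾ g) ≤ (f ⨾ g′)
  ⨾-monoʳ p = ⨾-mono ≤-refl p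

  sym-assoc : {f : A ⇒ B} {g : B ⇒ C} {k : C ⇒ D} → (f ⨾ (g ⨾ k)) ≈ ((f ⨾ g) ⨾ k)
  sym-assoc = ≈-sym assoc

  pullˡ : {f : A ⇒ B} {g : B ⇒ C} {k : C ⇒ D} {m : A ⇒ C} →
          (f ⨾ g) ≈ m → (f ⨾ (g ⨾ k)) ≈ (m ⨾ k)
  pullˡ p = ≈-trans sym-assoc (p ⟩⨾⟨refl)

  cancelˡ : {f : A ⇒ B} {g : B ⇒ A} {k : A ⇒ C} → (f ⨾ g) ≈ id → (f ⨾ (g ⨾ k)) ≈ k
  cancelˡ p = ≈-trans (pullˡ p) identityˡ

  cancelʳ : {k : C ⇒ A} {f : A ⇒ B} {g : B ⇒ A} → (f ⨾ g) ≈ id → (k ⨾ (f ⨾ g)) ≈ k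
  cancelʳ p = ≈-trans (refl⟩⨾⟨ p) identityʳ

  glue : {f : A ⇒ A′} {s : A′ ⇒ B′} {t : B′ ⇒ C′} {g : B ⇒ B′} {k : C ⇒ C′}
         {s′ : A ⇒ B} {t′ : B ⇒ C} →
         (f ⨾ s) ≈ (s′ ⨾ g) → (g ⨾ t) ≈ (t′ ⨾ k) → (f ⨾ s ⨾ t) ≈ ((s′ ⨾ t′) ⨾ k)
  glue p q = ≈-trans (pullˡ p) (≈-trans assoc (≈-trans (refl⟩⨾⟨ q) sym-assoc))

  inverse-nat : {i : A ⇒ B} {j : B ⇒ A} {i′ : A′ ⇒ B′} {j′ : B′ ⇒ A′} {f : A ⇒ A′} {g : B ⇒ B′} →
                (i′ ⨾ j′) ≈ id → (j ⨾ i) ≈ id → (f ⨾ i′) ≈ (i ⨾ g) → (j ⨾ f) ≈ (g ⨾ j′)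
  inverse-nat {i = i} {j} {i′} {j′} {f} {g} i′j′ ji nat = begin-equality
    j ⨾ f              ≈⟨ refl⟩⨾⟨ cancelʳ i′j′ ⟨
    j ⨾ f ⨾ i′ ⨾ j′    ≈⟨ refl⟩⨾⟨ pullˡ nat ⟩
    j ⨾ (i ⨾ g) ⨾ j′   ≈⟨ refl⟩⨾⟨ assoc ⟩
    j ⨾ i ⨾ g ⨾ j′     ≈⟨ cancelˡ ji ⟩
    g ⨾ j′             ∎
    where open HomReasoning

  infixr 4 _⟩⊕⟨_

  _⟩⊕⟨_ : {f f′ : A ⇒ B} {g g′ : C ⇒ D} → f ≈ f′ → g ≈ g′ → (f ⊕₁ g) ≈ (f′ ⊕₁ g′)
  (p , q) ⟩⊕⟨ (p′ , q′) = ⊕.●-mono p p′ , ⊕.●-mono q q′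

  ⊕-⨾ : {f : A ⇒ B} {g : B ⇒ C} {f′ : D ⇒ E} {g′ : E ⇒ A′} →
        ((f ⊕₁ f′) ⨾ (g ⊕₁ g′)) ≈ ((f ⨾ g) ⊕₁ (f′ ⨾ g′))
  ⊕-⨾ = ≈-sym ⊕.●-hom

  ⊕-inverse : {f : A ⇒ B} {g : B ⇒ A} {f′ : C ⇒ D} {g′ : D ⇒ C} →
              (f ⨾ g) ≈ id → (f′ ⨾ g′) ≈ id → ((f ⊕₁ f′) ⨾ (g ⊕₁ g′)) ≈ id
  ⊕-inverse p q = ≈-trans ⊕-⨾ (≈-trans (p ⟩⊕⟨ q) ⊕.●-id)

  ⊕-square : {f : A ⇒ A′} {g : A′ ⇒ C′} {g′ : A ⇒ C} {f′ : C ⇒ C′}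
             {p : B ⇒ B′} {q : B′ ⇒ D′} {q′ : B ⇒ D} {p′ : D ⇒ D′} →
             (f ⨾ g) ≈ (g′ ⨾ f′) → (p ⨾ q) ≈ (q′ ⨾ p′) →
             ((f ⊕₁ p) ⨾ (g ⊕₁ q)) ≈ ((g′ ⊕₁ q′) ⨾ (f′ ⊕₁ p′))
  ⊕-square sq sq′ = ≈-trans ⊕-⨾ (≈-trans (sq ⟩⊕⟨ sq′) ⊕.●-hom)

  id-square : {f : A ⇒ B} → (f ⨾ id) ≈ (id ⨾ f)
  id-square = ≈-trans identityʳ (≈-sym identityˡ)

  ⊕-split : {f : A ⇒ B} {g : C ⇒ D} → (f ⊕₁ g) ≈ ((f ⊕₁ id) ⨾ (id ⊕₁ g))
  ⊕-split = ≈-trans (≈-sym identityʳ ⟩⊕⟨ ≈-sym identityˡ) ⊕.●-hom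

  ⊕-split′ : {f : A ⇒ B} {g : C ⇒ D} → (f ⊕₁ g) ≈ ((id ⊕₁ g) ⨾ (f ⊕₁ id))
  ⊕-split′ = ≈-trans (≈-sym identityˡ ⟩⊕⟨ ≈-sym identityʳ) ⊕.●-hom

  α⊕⁻¹-nat : {f : A ⇒ A′} {g : B ⇒ B′} {k : C ⇒ C′} →
             ((f ⊕₁ (g ⊕₁ k)) ⨾ α⊕⁻¹) ≈ (α⊕⁻¹ ⨾ ((f ⊕₁ g) ⊕₁ k))
  α⊕⁻¹-nat = ≈-sym (inverse-nat ⊕.α-isoˡ ⊕.α-isoʳ ⊕.α-nat)

  lu⊕⁻¹-nat : {f : A ⇒ B} → (f ⨾ lu⊕⁻¹) ≈ (lu⊕⁻¹ ⨾ (id ⊕₁ f))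
  lu⊕⁻¹-nat = ≈-sym (inverse-nat ⊕.l-isoˡ ⊕.l-isoʳ ⊕.l-nat)

  ru⊕⁻¹-nat : {f : A ⇒ B} → (f ⨾ ru⊕⁻¹) ≈ (ru⊕⁻¹ ⨾ (f ⊕₁ id))
  ru⊕⁻¹-nat = ≈-sym (inverse-nat ⊕.ρ-isoˡ ⊕.ρ-isoʳ ⊕.ρ-nat)

  to-𝟘-unique : (x y : A ⇒ 𝟘) → x ≈ y
  to-𝟘-unique x y = ≈-trans (x≈! x) (≈-sym (x≈! y))
    where
    x≈! : (x : A ⇒ 𝟘) → x ≈ !
    x≈! x = ≈-trans (≈-sym identityʳ) (≈-trans (refl⟩⨾⟨ ≈-sym !-𝟘) !-nat)

  from-𝟘-unique : (x y : 𝟘 ⇒ A) → x ≈ y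
  from-𝟘-unique x y = ≈-trans (x≈¡ x) (≈-sym (x≈¡ y))
    where
    x≈¡ : (x : 𝟘 ⇒ A) → x ≈ ¡
    x≈¡ x = ≈-trans (≈-sym identityˡ) (≈-trans (≈-sym ¡-𝟘 ⟩⨾⟨refl) ¡-nat)

  ι₁ : A ⇒ (A ⊕₀ B)
  ι₁ = ru⊕⁻¹ ⨾ (id ⊕₁ ¡)

  ι₂ : ∀ {A B} → B ⇒ (A ⊕₀ B)
  ι₂ = lu⊕⁻¹ ⨾ (¡ ⊕₁ id)

  π₁ : (A ⊕₀ B) ⇒ A
  π₁ = (id ⊕₁ !) ⨾ ru⊕

  π₂ : ∀ {A B} → (A ⊕₀ B) ⇒ B
  π₂ = (! ⊕₁ id) ⨾ lu⊕

  [_,_] : A ⇒ C → B ⇒ C → (A ⊕₀ B) ⇒ C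
  [ p , q ] = (p ⊕₁ q) ⨾ ∇

  ι₁-∇ : (ι₁ ⨾ ∇) ≈ id {A}
  ι₁-∇ = ≈-trans assoc ∇-unitʳ

  ι₂-∇ : (ι₂ ⨾ ∇) ≈ id {A}
  ι₂-∇ = ≈-trans assoc ∇-unitˡ

  ι₁-⊕ : {p : A ⇒ B} {q : C ⇒ D} → (ι₁ ⨾ (p ⊕₁ q)) ≈ (p ⨾ ι₁)
  ι₁-⊕ = begin-equality
    (ru⊕⁻¹ ⨾ (id ⊕₁ ¡)) ⨾ (_ ⊕₁ _)   ≈⟨ assoc ⟩
    ru⊕⁻¹ ⨾ (id ⊕₁ ¡) ⨾ (_ ⊕₁ _)     ≈⟨ refl⟩⨾⟨ ⊕-square (≈-sym id-square) (from-𝟘-unique _ _) ⟩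
    ru⊕⁻¹ ⨾ (_ ⊕₁ id) ⨾ (id ⊕₁ ¡)    ≈⟨ pullˡ (≈-sym ru⊕⁻¹-nat) ⟩
    (_ ⨾ ru⊕⁻¹) ⨾ (id ⊕₁ ¡)          ≈⟨ assoc ⟩
    _ ⨾ ι₁                           ∎
    where open HomReasoning

  ι₂-⊕ : {p : A ⇒ B} {q : C ⇒ D} → (ι₂ ⨾ (p ⊕₁ q)) ≈ (q ⨾ ι₂)
  ι₂-⊕ = begin-equality
    (lu⊕⁻¹ ⨾ (¡ ⊕₁ id)) ⨾ (_ ⊕₁ _)   ≈⟨ assoc ⟩
    lu⊕⁻¹ ⨾ (¡ ⊕₁ id) ⨾ (_ ⊕₁ _)     ≈⟨ refl⟩⨾⟨ ⊕-square (from-𝟘-unique _ _) (≈-sym id-square) ⟩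
    lu⊕⁻¹ ⨾ (id ⊕₁ _) ⨾ (¡ ⊕₁ id)    ≈⟨ pullˡ (≈-sym lu⊕⁻¹-nat) ⟩
    (_ ⨾ lu⊕⁻¹) ⨾ (¡ ⊕₁ id)          ≈⟨ assoc ⟩
    _ ⨾ ι₂                           ∎
    where open HomReasoning

  ι₁-copair : {p : A ⇒ C} {q : B ⇒ C} → (ι₁ ⨾ [ p , q ]) ≈ p
  ι₁-copair = ≈-trans (pullˡ ι₁-⊕) (≈-trans assoc (cancelʳ ι₁-∇))

  ι₂-copair : {p : A ⇒ C} {q : B ⇒ C} → (ι₂ ⨾ [ p , q ]) ≈ q
  ι₂-copair = ≈-trans (pullˡ ι₂-⊕) (≈-trans assoc (cancelʳ ι₂-∇))

  π₁⨾ι₁≤id : (π₁ ⨾ ι₁) ≤ id {A ⊕₀ B}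
  π₁⨾ι₁≤id = begin
    ((id ⊕₁ !) ⨾ ru⊕) ⨾ ru⊕⁻¹ ⨾ (id ⊕₁ ¡)   ≈⟨ ≈-trans assoc (refl⟩⨾⟨ cancelˡ ⊕.ρ-isoˡ) ⟩
    (id ⊕₁ !) ⨾ (id ⊕₁ ¡)                  ≈⟨ ⊕-⨾ ⟩
    (id ⨾ id) ⊕₁ (! ⨾ ¡)                   ≤⟨ ⊕.●-mono (≈⇒≤ identityˡ) !¡-ineq ⟩
    id ⊕₁ id                               ≈⟨ ⊕.●-id ⟩
    id                                     ∎
    where open HomReasoning

  π₂⨾ι₂≤id : (π₂ ⨾ ι₂) ≤ id {A ⊕₀ B}
  π₂⨾ι₂≤id = begin
    ((! ⊕₁ id) ⨾ lu⊕) ⨾ lu⊕⁻¹ ⨾ (¡ ⊕₁ id)   ≈⟨ ≈-trans assoc (refl⟩⨾⟨ cancelˡ ⊕.l-isoˡ) ⟩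
    (! ⊕₁ id) ⨾ (¡ ⊕₁ id)                  ≈⟨ ⊕-⨾ ⟩
    (! ⨾ ¡) ⊕₁ (id ⨾ id)                   ≤⟨ ⊕.●-mono !¡-ineq (≈⇒≤ identityˡ) ⟩
    id ⊕₁ id                               ≈⟨ ⊕.●-id ⟩
    id                                     ∎
    where open HomReasoning

  ∇-unitˡ′ : ((¡ ⊕₁ id) ⨾ ∇) ≈ lu⊕ {A}
  ∇-unitˡ′ = begin-equality
    (¡ ⊕₁ id) ⨾ ∇                    ≈⟨ identityˡ ⟨
    id ⨾ (¡ ⊕₁ id) ⨾ ∇               ≈⟨ ⊕.l-isoˡ ⟩⨾⟨refl ⟨
    (lu⊕ ⨾ lu⊕⁻¹) ⨾ (¡ ⊕₁ id) ⨾ ∇    ≈⟨ assoc ⟩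
    lu⊕ ⨾ lu⊕⁻¹ ⨾ (¡ ⊕₁ id) ⨾ ∇      ≈⟨ cancelʳ ∇-unitˡ ⟩
    lu⊕                              ∎
    where open HomReasoning

  ∇-unitʳ′ : ((id ⊕₁ ¡) ⨾ ∇) ≈ ru⊕ {A}
  ∇-unitʳ′ = begin-equality
    (id ⊕₁ ¡) ⨾ ∇                    ≈⟨ identityˡ ⟨
    id ⨾ (id ⊕₁ ¡) ⨾ ∇               ≈⟨ ⊕.ρ-isoˡ ⟩⨾⟨refl ⟨
    (ru⊕ ⨾ ru⊕⁻¹) ⨾ (id ⊕₁ ¡) ⨾ ∇    ≈⟨ assoc ⟩
    ru⊕ ⨾ ru⊕⁻¹ ⨾ (id ⊕₁ ¡) ⨾ ∇      ≈⟨ cancelʳ ∇-unitʳ ⟩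
    ru⊕                              ∎
    where open HomReasoning

  σ⊕-lu⊕ : (σ⊕ ⨾ lu⊕) ≈ ru⊕ {A}
  σ⊕-lu⊕ = begin-equality
    σ⊕ ⨾ lu⊕                 ≈⟨ refl⟩⨾⟨ ∇-unitˡ′ ⟨
    σ⊕ ⨾ (¡ ⊕₁ id) ⨾ ∇       ≈⟨ pullˡ (≈-sym ⊕.σ-nat) ⟩
    ((id ⊕₁ ¡) ⨾ σ⊕) ⨾ ∇     ≈⟨ ≈-trans assoc (refl⟩⨾⟨ ∇-comm) ⟩
    (id ⊕₁ ¡) ⨾ ∇            ≈⟨ ∇-unitʳ′ ⟩
    ru⊕                      ∎
    where open HomReasoning

  ru⊕⁻¹-σ⊕ : (ru⊕⁻¹ ⨾ σ⊕) ≈ lu⊕⁻¹ {A}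
  ru⊕⁻¹-σ⊕ = begin-equality
    ru⊕⁻¹ ⨾ σ⊕                   ≈⟨ refl⟩⨾⟨ cancelʳ ⊕.l-isoˡ ⟨
    ru⊕⁻¹ ⨾ σ⊕ ⨾ lu⊕ ⨾ lu⊕⁻¹     ≈⟨ refl⟩⨾⟨ pullˡ σ⊕-lu⊕ ⟩
    ru⊕⁻¹ ⨾ ru⊕ ⨾ lu⊕⁻¹          ≈⟨ cancelˡ ⊕.ρ-isoʳ ⟩
    lu⊕⁻¹                        ∎
    where open HomReasoning

  ι₁-σ⊕ : (ι₁ ⨾ σ⊕) ≈ ι₂ {A} {B}
  ι₁-σ⊕ = ≈-trans assoc (≈-trans (refl⟩⨾⟨ ⊕.σ-nat) (pullˡ ru⊕⁻¹-σ⊕))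

  ι₂-σ⊕ : (ι₂ ⨾ σ⊕) ≈ ι₁ {A} {B}
  ι₂-σ⊕ = ≈-trans (≈-sym ι₁-σ⊕ ⟩⨾⟨refl) (≈-trans assoc (cancelʳ ⊕.σ-inv))

  σ⊕-𝟘 : σ⊕ {𝟘} {𝟘} ≈ id
  σ⊕-𝟘 = ≈-trans (≈-sym (cancelʳ ⊕.l-isoˡ)) (≈-trans (pullˡ (to-𝟘-unique _ _)) ⊕.l-isoˡ)

  shuffle-nat : {p : A ⇒ A′} {q : B ⇒ B′} {x : C ⇒ C′} {y : D ⇒ D′} →
                (((p ⊕₁ q) ⊕₁ (x ⊕₁ y)) ⨾ shuffle) ≈ (shuffle ⨾ ((p ⊕₁ x) ⊕₁ (q ⊕₁ y)))
  shuffle-nat =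
    glue ⊕.α-nat (glue (⊕-square id-square α⊕⁻¹-nat)
      (glue (⊕-square id-square (⊕-square ⊕.σ-nat id-square))
        (glue (⊕-square id-square ⊕.α-nat) α⊕⁻¹-nat)))

  shuffle-𝟘 : shuffle {A} {𝟘} {𝟘} {B} ≈ id
  shuffle-𝟘 = begin-equality
    α⊕ ⨾ (id ⊕₁ α⊕⁻¹) ⨾ (id ⊕₁ (σ⊕ ⊕₁ id)) ⨾ (id ⊕₁ α⊕) ⨾ α⊕⁻¹
      ≈⟨ refl⟩⨾⟨ refl⟩⨾⟨ (≈-trans (≈-refl ⟩⊕⟨ ≈-trans (σ⊕-𝟘 ⟩⊕⟨ ≈-refl) ⊕.●-id) ⊕.●-id ⟩⨾⟨refl) ⟩
    α⊕ ⨾ (id ⊕₁ α⊕⁻¹) ⨾ id ⨾ (id ⊕₁ α⊕) ⨾ α⊕⁻¹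
      ≈⟨ refl⟩⨾⟨ refl⟩⨾⟨ identityˡ ⟩
    α⊕ ⨾ (id ⊕₁ α⊕⁻¹) ⨾ (id ⊕₁ α⊕) ⨾ α⊕⁻¹
      ≈⟨ refl⟩⨾⟨ cancelˡ (⊕-inverse identityˡ ⊕.α-isoʳ) ⟩
    α⊕ ⨾ α⊕⁻¹
      ≈⟨ ⊕.α-isoˡ ⟩
    id ∎
    where open HomReasoning

  [,]-η : [ ι₁ , ι₂ ] ≈ id {A ⊕₀ B}
  [,]-η = begin-equality
    ((ru⊕⁻¹ ⨾ (id ⊕₁ ¡)) ⊕₁ (lu⊕⁻¹ ⨾ (¡ ⊕₁ id))) ⨾ ∇
      ≈⟨ ⊕.●-hom ⟩⨾⟨ ∇-⊕ ⟩
    ((ru⊕⁻¹ ⊕₁ lu⊕⁻¹) ⨾ ((id ⊕₁ ¡) ⊕₁ (¡ ⊕₁ id))) ⨾ shuffle ⨾ (∇ ⊕₁ ∇)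
      ≈⟨ ≈-trans assoc (refl⟩⨾⟨ pullˡ shuffle-nat) ⟩
    (ru⊕⁻¹ ⊕₁ lu⊕⁻¹) ⨾ (shuffle ⨾ ((id ⊕₁ ¡) ⊕₁ (¡ ⊕₁ id))) ⨾ (∇ ⊕₁ ∇)
      ≈⟨ refl⟩⨾⟨ (≈-trans (shuffle-𝟘 ⟩⨾⟨refl) identityˡ ⟩⨾⟨refl) ⟩
    (ru⊕⁻¹ ⊕₁ lu⊕⁻¹) ⨾ ((id ⊕₁ ¡) ⊕₁ (¡ ⊕₁ id)) ⨾ (∇ ⊕₁ ∇)
      ≈⟨ ≈-trans (refl⟩⨾⟨ ⊕-⨾) ⊕-⨾ ⟩
    (ru⊕⁻¹ ⨾ (id ⊕₁ ¡) ⨾ ∇) ⊕₁ (lu⊕⁻¹ ⨾ (¡ ⊕₁ id) ⨾ ∇)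
      ≈⟨ ∇-unitʳ ⟩⊕⟨ ∇-unitˡ ⟩
    id ⊕₁ id
      ≈⟨ ⊕.●-id ⟩
    id ∎
    where open HomReasoning

  copair-η : {x : (A ⊕₀ B) ⇒ C} → x ≈ [ ι₁ ⨾ x , ι₂ ⨾ x ]
  copair-η {x = x} = begin-equality
    x                          ≈⟨ identityˡ ⟨
    id ⨾ x                     ≈⟨ [,]-η ⟩⨾⟨refl ⟨
    ((ι₁ ⊕₁ ι₂) ⨾ ∇) ⨾ x       ≈⟨ ≈-trans assoc (refl⟩⨾⟨ ∇-nat) ⟩
    (ι₁ ⊕₁ ι₂) ⨾ (x ⊕₁ x) ⨾ ∇  ≈⟨ pullˡ ⊕-⨾ ⟩
    [ ι₁ ⨾ x , ι₂ ⨾ x ]        ∎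
    where open HomReasoning

  ≤-by-cases : {x y : (A ⊕₀ B) ⇒ C} → (ι₁ ⨾ x) ≤ (ι₁ ⨾ y) → (ι₂ ⨾ x) ≤ (ι₂ ⨾ y) → x ≤ y
  ≤-by-cases p q = ≤-trans (≈⇒≤ copair-η) (≤-trans (⨾-monoˡ (⊕.●-mono p q)) (≈⇒≥ copair-η))

  ≈-by-cases : {x y : (A ⊕₀ B) ⇒ C} → (ι₁ ⨾ x) ≈ (ι₁ ⨾ y) → (ι₂ ⨾ x) ≈ (ι₂ ⨾ y) → x ≈ y
  ≈-by-cases p q = ≤-by-cases (≈⇒≤ p) (≈⇒≤ q) , ≤-by-cases (≈⇒≥ p) (≈⇒≥ q)

  triangle′ : ((ru⊕⁻¹ ⊕₁ id) ⨾ α⊕) ≈ (id {A} ⊕₁ lu⊕⁻¹ {B})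
  triangle′ = begin-equality
    (ru⊕⁻¹ ⊕₁ id) ⨾ α⊕                          ≈⟨ refl⟩⨾⟨ cancelʳ (⊕-inverse identityˡ ⊕.l-isoˡ) ⟨
    (ru⊕⁻¹ ⊕₁ id) ⨾ α⊕ ⨾ (id ⊕₁ lu⊕) ⨾ (id ⊕₁ lu⊕⁻¹)  ≈⟨ refl⟩⨾⟨ pullˡ ⊕.triangle ⟩
    (ru⊕⁻¹ ⊕₁ id) ⨾ (ru⊕ ⊕₁ id) ⨾ (id ⊕₁ lu⊕⁻¹)      ≈⟨ cancelˡ (⊕-inverse ⊕.ρ-isoʳ identityˡ) ⟩
    id ⊕₁ lu⊕⁻¹                                 ∎
    where open HomReasoning

  triangle⁻¹ : ((id ⊕₁ lu⊕⁻¹) ⨾ α⊕⁻¹) ≈ (ru⊕⁻¹ {A} ⊕₁ id {B})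
  triangle⁻¹ = ≈-trans (≈-sym triangle′ ⟩⨾⟨refl) (≈-trans assoc (cancelʳ ⊕.α-isoˡ))

  pull₃ : {f : A ⇒ B} {g : B ⇒ C} {k : C ⇒ D} {l : D ⇒ E} {m : A ⇒ D} →
          (f ⨾ g ⨾ k) ≈ m → (f ⨾ g ⨾ k ⨾ l) ≈ (m ⨾ l)
  pull₃ p = ≈-trans (refl⟩⨾⟨ sym-assoc) (pullˡ p)

  ι₁-α⊕⁻¹ : (ι₁ {A} {B ⊕₀ C} ⨾ α⊕⁻¹) ≈ (ι₁ ⨾ ι₁)
  ι₁-α⊕⁻¹ = begin-equality
    (ru⊕⁻¹ ⨾ (id ⊕₁ ¡)) ⨾ α⊕⁻¹                          ≈⟨ assoc ⟩
    ru⊕⁻¹ ⨾ (id ⊕₁ ¡) ⨾ α⊕⁻¹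
      ≈⟨ refl⟩⨾⟨ (≈-trans (≈-sym identityˡ ⟩⊕⟨ ¡-⊕) ⊕.●-hom ⟩⨾⟨refl) ⟩
    ru⊕⁻¹ ⨾ ((id ⊕₁ lu⊕⁻¹) ⨾ (id ⊕₁ (¡ ⊕₁ ¡))) ⨾ α⊕⁻¹
      ≈⟨ refl⟩⨾⟨ ≈-trans assoc (refl⟩⨾⟨ α⊕⁻¹-nat) ⟩
    ru⊕⁻¹ ⨾ (id ⊕₁ lu⊕⁻¹) ⨾ α⊕⁻¹ ⨾ ((id ⊕₁ ¡) ⊕₁ ¡)     ≈⟨ refl⟩⨾⟨ pullˡ triangle⁻¹ ⟩
    ru⊕⁻¹ ⨾ (ru⊕⁻¹ ⊕₁ id) ⨾ ((id ⊕₁ ¡) ⊕₁ ¡)           ≈⟨ refl⟩⨾⟨ ⊕-square (≈-sym identityʳ) ≈-refl ⟩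
    ru⊕⁻¹ ⨾ (ι₁ ⊕₁ id) ⨾ (id ⊕₁ ¡)                     ≈⟨ pullˡ (≈-sym ru⊕⁻¹-nat) ⟩
    (ι₁ ⨾ ru⊕⁻¹) ⨾ (id ⊕₁ ¡)                           ≈⟨ assoc ⟩
    ι₁ ⨾ ι₁                                            ∎
    where open HomReasoning

  ι₂-α⊕ : (ι₂ {A ⊕₀ B} {C} ⨾ α⊕) ≈ (ι₂ ⨾ ι₂)
  ι₂-α⊕ = begin-equality
    (lu⊕⁻¹ ⨾ (¡ ⊕₁ id)) ⨾ α⊕                            ≈⟨ assoc ⟩
    lu⊕⁻¹ ⨾ (¡ ⊕₁ id) ⨾ α⊕
      ≈⟨ refl⟩⨾⟨ (≈-trans (¡-⊕ ⟩⊕⟨ ≈-sym identityˡ) ⊕.●-hom ⟩⨾⟨refl) ⟩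
    lu⊕⁻¹ ⨾ ((lu⊕⁻¹ ⊕₁ id) ⨾ ((¡ ⊕₁ ¡) ⊕₁ id)) ⨾ α⊕
      ≈⟨ refl⟩⨾⟨ ≈-trans assoc (refl⟩⨾⟨ ⊕.α-nat) ⟩
    lu⊕⁻¹ ⨾ (lu⊕⁻¹ ⊕₁ id) ⨾ α⊕ ⨾ (¡ ⊕₁ (¡ ⊕₁ id))
      ≈⟨ refl⟩⨾⟨ pullˡ (≈-trans ((from-𝟘-unique _ _ ⟩⊕⟨ ≈-refl) ⟩⨾⟨refl) triangle′) ⟩
    lu⊕⁻¹ ⨾ (id ⊕₁ lu⊕⁻¹) ⨾ (¡ ⊕₁ (¡ ⊕₁ id))           ≈⟨ refl⟩⨾⟨ ⊕-square ≈-refl (≈-sym identityʳ) ⟩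
    lu⊕⁻¹ ⨾ (id ⊕₁ ι₂) ⨾ (¡ ⊕₁ id)                     ≈⟨ pullˡ (≈-sym lu⊕⁻¹-nat) ⟩
    (ι₂ ⨾ lu⊕⁻¹) ⨾ (¡ ⊕₁ id)                           ≈⟨ assoc ⟩
    ι₂ ⨾ ι₂                                            ∎
    where open HomReasoning

  ι₁ι₁-α⊕ : (ι₁ ⨾ ι₁ {A ⊕₀ B} {C} ⨾ α⊕) ≈ ι₁
  ι₁ι₁-α⊕ = ≈-trans (pullˡ (≈-sym ι₁-α⊕⁻¹)) (≈-trans assoc (cancelʳ ⊕.α-isoʳ))

  ι₂ι₂-α⊕⁻¹ : (ι₂ ⨾ ι₂ {A} {B ⊕₀ C} ⨾ α⊕⁻¹) ≈ ι₂
  ι₂ι₂-α⊕⁻¹ = ≈-trans (pullˡ (≈-sym ι₂-α⊕)) (≈-trans assoc (cancelʳ ⊕.α-isoˡ))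

  hexagon′ : ((σ⊕ ⊕₁ id) ⨾ α⊕) ≈ (α⊕ {A} {B} {C} ⨾ σ⊕ ⨾ α⊕ ⨾ (id ⊕₁ σ⊕))
  hexagon′ = begin-equality
    (σ⊕ ⊕₁ id) ⨾ α⊕                                ≈⟨ cancelʳ (⊕-inverse identityˡ ⊕.σ-inv) ⟨
    ((σ⊕ ⊕₁ id) ⨾ α⊕) ⨾ (id ⊕₁ σ⊕) ⨾ (id ⊕₁ σ⊕)    ≈⟨ pullˡ (≈-trans assoc (≈-sym ⊕.hexagon)) ⟩
    (α⊕ ⨾ σ⊕ ⨾ α⊕) ⨾ (id ⊕₁ σ⊕)                     ≈⟨ ≈-trans assoc (refl⟩⨾⟨ assoc) ⟩
    α⊕ ⨾ σ⊕ ⨾ α⊕ ⨾ (id ⊕₁ σ⊕)                       ∎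
    where open HomReasoning

  ι₂ι₁-α⊕ : (ι₂ {A} {B} ⨾ ι₁ {A ⊕₀ B} {C} ⨾ α⊕) ≈ (ι₁ ⨾ ι₂)
  ι₂ι₁-α⊕ = begin-equality
    ι₂ ⨾ ι₁ ⨾ α⊕                          ≈⟨ ι₁-σ⊕ ⟩⨾⟨refl ⟨
    (ι₁ ⨾ σ⊕) ⨾ ι₁ ⨾ α⊕                    ≈⟨ ≈-trans assoc (refl⟩⨾⟨ pullˡ (≈-sym ι₁-⊕)) ⟩
    ι₁ ⨾ (ι₁ ⨾ (σ⊕ ⊕₁ id)) ⨾ α⊕            ≈⟨ refl⟩⨾⟨ ≈-trans assoc (refl⟩⨾⟨ hexagon′) ⟩
    ι₁ ⨾ ι₁ ⨾ α⊕ ⨾ σ⊕ ⨾ α⊕ ⨾ (id ⊕₁ σ⊕)    ≈⟨ pull₃ ι₁ι₁-α⊕ ⟩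
    ι₁ ⨾ σ⊕ ⨾ α⊕ ⨾ (id ⊕₁ σ⊕)              ≈⟨ pullˡ ι₁-σ⊕ ⟩
    ι₂ ⨾ α⊕ ⨾ (id ⊕₁ σ⊕)                   ≈⟨ pullˡ ι₂-α⊕ ⟩
    (ι₂ ⨾ ι₂) ⨾ (id ⊕₁ σ⊕)                 ≈⟨ ≈-trans assoc (refl⟩⨾⟨ ι₂-⊕) ⟩
    ι₂ ⨾ σ⊕ ⨾ ι₂                           ≈⟨ pullˡ ι₂-σ⊕ ⟩
    ι₁ ⨾ ι₂                                ∎
    where open HomReasoning

  ι₁ι₂-α⊕⁻¹ : (ι₁ {B} {C} ⨾ ι₂ {A} {B ⊕₀ C} ⨾ α⊕⁻¹) ≈ (ι₂ ⨾ ι₁)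
  ι₁ι₂-α⊕⁻¹ = ≈-trans (pullˡ (≈-sym ι₂ι₁-α⊕))
                      (≈-trans assoc (refl⟩⨾⟨ ≈-trans assoc (cancelʳ ⊕.α-isoˡ)))

  ι₂-α⊕⁻¹-∇ : (ι₂ {A} {A ⊕₀ B} ⨾ α⊕⁻¹ ⨾ (∇ ⊕₁ id)) ≈ id
  ι₂-α⊕⁻¹-∇ = ≈-by-cases on-ι₁ on-ι₂
    where
    open HomReasoning
    on-ι₁ : (ι₁ ⨾ ι₂ ⨾ α⊕⁻¹ ⨾ (∇ ⊕₁ id)) ≈ (ι₁ ⨾ id)
    on-ι₁ = begin-equality
      ι₁ ⨾ ι₂ ⨾ α⊕⁻¹ ⨾ (∇ ⊕₁ id)   ≈⟨ pull₃ ι₁ι₂-α⊕⁻¹ ⟩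
      (ι₂ ⨾ ι₁) ⨾ (∇ ⊕₁ id)        ≈⟨ ≈-trans assoc (refl⟩⨾⟨ ι₁-⊕) ⟩
      ι₂ ⨾ ∇ ⨾ ι₁                  ≈⟨ cancelˡ ι₂-∇ ⟩
      ι₁                           ≈⟨ identityʳ ⟨
      ι₁ ⨾ id                      ∎
    on-ι₂ : (ι₂ ⨾ ι₂ ⨾ α⊕⁻¹ ⨾ (∇ ⊕₁ id)) ≈ (ι₂ ⨾ id)
    on-ι₂ = begin-equality
      ι₂ ⨾ ι₂ ⨾ α⊕⁻¹ ⨾ (∇ ⊕₁ id)   ≈⟨ pull₃ ι₂ι₂-α⊕⁻¹ ⟩
      ι₂ ⨾ (∇ ⊕₁ id)               ≈⟨ ι₂-⊕ ⟩
      id ⨾ ι₂                      ≈⟨ id-square ⟨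
      ι₂ ⨾ id                      ∎

  ⨾-id⊕id : {f : A ⇒ (B ⊕₀ C)} → (f ⨾ (id ⊕₁ id)) ≈ f
  ⨾-id⊕id = ≈-trans (refl⟩⨾⟨ ⊕.●-id) identityʳ

  id⊕id-⨾ : {f : (A ⊕₀ B) ⇒ C} → ((id ⊕₁ id) ⨾ f) ≈ f
  id⊕id-⨾ = ≈-trans (⊕.●-id ⟩⨾⟨refl) identityˡ

  tr-mono : {f g : (S ⊕₀ A) ⇒ (S ⊕₀ B)} → f ≤ g → tr f ≤ tr g
  tr-mono f≤g = AU1 {r = id} (≤-trans (≈⇒≤ ⨾-id⊕id) (≤-trans f≤g (≈⇒≥ id⊕id-⨾)))

  tr-cong : {f g : (S ⊕₀ A) ⇒ (S ⊕₀ B)} → f ≈ g → tr f ≈ tr g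
  tr-cong (f≤g , g≤f) = tr-mono f≤g , tr-mono g≤f

  tr-precompose : {g : C ⇒ A} {f : (S ⊕₀ A) ⇒ (S ⊕₀ B)} → tr ((id ⊕₁ g) ⨾ f) ≈ (g ⨾ tr f)
  tr-precompose = ≈-trans (tr-cong (refl⟩⨾⟨ ≈-sym ⨾-id⊕id)) (≈-trans tr-tightening (refl⟩⨾⟨ identityʳ))

  tr-postcompose : {k : B ⇒ C} {f : (S ⊕₀ A) ⇒ (S ⊕₀ B)} → tr (f ⨾ (id ⊕₁ k)) ≈ (tr f ⨾ k)
  tr-postcompose = ≈-trans (tr-cong (≈-sym id⊕id-⨾)) (≈-trans tr-tightening identityˡ)

  tr-delay : {q : D ⇒ B} {p : A ⇒ D} → tr ((q ⊕₁ p) ⨾ σ⊕) ≈ (p ⨾ q)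
  tr-delay {q = q} {p} = begin-equality
    tr ((q ⊕₁ p) ⨾ σ⊕)                 ≈⟨ tr-cong (≈-trans (⊕-split′ ⟩⨾⟨refl) assoc) ⟩
    tr ((id ⊕₁ p) ⨾ (q ⊕₁ id) ⨾ σ⊕)    ≈⟨ tr-precompose ⟩
    p ⨾ tr ((q ⊕₁ id) ⨾ σ⊕)            ≈⟨ refl⟩⨾⟨ tr-cong ⊕.σ-nat ⟩
    p ⨾ tr (σ⊕ ⨾ (id ⊕₁ q))            ≈⟨ refl⟩⨾⟨ tr-postcompose ⟩
    p ⨾ tr σ⊕ ⨾ q                      ≈⟨ refl⟩⨾⟨ ≈-trans (tr-yanking ⟩⨾⟨refl) identityˡ ⟩
    p ⨾ q                              ∎
    where open HomReasoning

  bypass≤tr : {x : A ⇒ B} {f : (S ⊕₀ A) ⇒ (S ⊕₀ B)} → (x ⨾ ι₂) ≤ (ι₂ ⨾ f) → x ≤ tr f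
  bypass≤tr {x = x} {f} x≤f = begin
    x                          ≈⟨ trace-over-𝟘 ⟨
    tr (lu⊕ ⨾ x ⨾ lu⊕⁻¹)       ≤⟨ AU1 {r = ¡} step ⟩
    tr f                       ∎
    where
    open HomReasoning
    trace-over-𝟘 : tr (lu⊕ ⨾ x ⨾ lu⊕⁻¹) ≈ x
    trace-over-𝟘 = begin-equality
      tr (lu⊕ ⨾ x ⨾ lu⊕⁻¹)              ≈⟨ tr-vanishing ⟩
      lu⊕⁻¹ ⨾ (lu⊕ ⨾ x ⨾ lu⊕⁻¹) ⨾ lu⊕  ≈⟨ ≈-trans (refl⟩⨾⟨ assoc) (≈-trans (cancelˡ ⊕.l-isoʳ) assoc) ⟩
      x ⨾ lu⊕⁻¹ ⨾ lu⊕                  ≈⟨ cancelʳ ⊕.l-isoʳ ⟩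
      x                                ∎
    step : ((lu⊕ ⨾ x ⨾ lu⊕⁻¹) ⨾ (¡ ⊕₁ id)) ≤ ((¡ ⊕₁ id) ⨾ f)
    step = begin
      (lu⊕ ⨾ x ⨾ lu⊕⁻¹) ⨾ (¡ ⊕₁ id)   ≈⟨ ≈-trans assoc (refl⟩⨾⟨ assoc) ⟩
      lu⊕ ⨾ x ⨾ ι₂                    ≤⟨ ⨾-monoʳ x≤f ⟩
      lu⊕ ⨾ ι₂ ⨾ f                    ≈⟨ refl⟩⨾⟨ assoc ⟩
      lu⊕ ⨾ lu⊕⁻¹ ⨾ (¡ ⊕₁ id) ⨾ f     ≈⟨ cancelˡ ⊕.l-isoˡ ⟩
      (¡ ⊕₁ id) ⨾ f                   ∎

  comp-ST≈ : (f : (S ⊕₀ X) ⇒ (A ⊕₀ Y)) → comp-ST f ≈ (ι₁ ⨾ f ⨾ π₁)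
  comp-ST≈ f = sym-assoc

  comp-SY≈ : (f : (S ⊕₀ X) ⇒ (A ⊕₀ Y)) → comp-SY f ≈ (ι₁ ⨾ f ⨾ π₂)
  comp-SY≈ f = sym-assoc

  comp-XT≈ : (f : (S ⊕₀ X) ⇒ (A ⊕₀ Y)) → comp-XT f ≈ (ι₂ ⨾ f ⨾ π₁)
  comp-XT≈ f = sym-assoc

  comp-XY≈ : (f : (S ⊕₀ X) ⇒ (A ⊕₀ Y)) → comp-XY f ≈ (ι₂ ⨾ f ⨾ π₂)
  comp-XY≈ f = sym-assoc

  -- f_SS* ⨾ f_SY in the paper's notation.
  trFromState : (S ⊕₀ X) ⇒ (S ⊕₀ Y) → S ⇒ Y
  trFromState f = tr (∇ ⨾ ι₁ ⨾ f)

  module Unfolding (f : (S ⊕₀ X) ⇒ (S ⊕₀ Y)) where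

    enter : X ⇒ S
    enter = ι₂ ⨾ f ⨾ π₁

    loop : (S ⊕₀ S) ⇒ (S ⊕₀ Y)
    loop = ∇ ⨾ ι₁ ⨾ f

    -- Two copies of the state: X enters the first through enter, and loop reads either
    -- copy and writes to the second.
    doubled : ((S ⊕₀ S) ⊕₀ X) ⇒ ((S ⊕₀ S) ⊕₀ Y)
    doubled = [ loop ⨾ ι₂ ⨾ α⊕⁻¹ , enter ⨾ ι₁ ⨾ ι₁ ]

    inner : (S ⊕₀ (S ⊕₀ X)) ⇒ (S ⊕₀ (S ⊕₀ Y))
    inner = α⊕⁻¹ ⨾ doubled ⨾ α⊕

    tr-doubled≤tr : tr doubled ≤ tr f
    tr-doubled≤tr = AU1 {r = ∇} (≤-by-cases from-states from-input)
      where
      open HomReasoning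
      from-states : (ι₁ ⨾ doubled ⨾ (∇ ⊕₁ id)) ≤ (ι₁ ⨾ (∇ ⊕₁ id) ⨾ f)
      from-states = begin
        ι₁ ⨾ doubled ⨾ (∇ ⊕₁ id)   ≈⟨ ≈-trans (pullˡ ι₁-copair) (≈-trans assoc (refl⟩⨾⟨ ≈-trans assoc ι₂-α⊕⁻¹-∇)) ⟩
        loop ⨾ id                 ≈⟨ identityʳ ⟩
        ∇ ⨾ ι₁ ⨾ f                ≈⟨ ≈-trans (pullˡ ι₁-⊕) assoc ⟨
        ι₁ ⨾ (∇ ⊕₁ id) ⨾ f        ∎
      from-input : (ι₂ ⨾ doubled ⨾ (∇ ⊕₁ id)) ≤ (ι₂ ⨾ (∇ ⊕₁ id) ⨾ f)
      from-input = begin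
        ι₂ ⨾ doubled ⨾ (∇ ⊕₁ id)   ≈⟨ ≈-trans (pullˡ ι₂-copair) (≈-trans assoc (refl⟩⨾⟨ ≈-trans assoc (refl⟩⨾⟨ ι₁-⊕))) ⟩
        enter ⨾ ι₁ ⨾ ∇ ⨾ ι₁        ≈⟨ refl⟩⨾⟨ cancelˡ ι₁-∇ ⟩
        (ι₂ ⨾ f ⨾ π₁) ⨾ ι₁         ≈⟨ ≈-trans assoc (refl⟩⨾⟨ assoc) ⟩
        ι₂ ⨾ f ⨾ π₁ ⨾ ι₁           ≤⟨ ⨾-monoʳ (⨾-monoʳ π₁⨾ι₁≤id) ⟩
        ι₂ ⨾ f ⨾ id                ≈⟨ refl⟩⨾⟨ identityʳ ⟩
        ι₂ ⨾ f                     ≈⟨ ≈-trans (pullˡ ι₂-⊕) (identityˡ ⟩⨾⟨refl) ⟨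
        ι₂ ⨾ (∇ ⊕₁ id) ⨾ f         ∎

    ι₁-doubled-α⊕ : (ι₁ ⨾ doubled ⨾ α⊕) ≈ (loop ⨾ ι₂)
    ι₁-doubled-α⊕ = ≈-trans (pullˡ ι₁-copair) (≈-trans assoc (refl⟩⨾⟨ ≈-trans assoc (cancelʳ ⊕.α-isoʳ)))

    -- Tracing out the first copy: from the state it is never visited (bypass≤tr),
    -- from X it delays enter by one step (tr-delay).
    entered-loop≤tr-inner : ((id ⊕₁ enter) ⨾ loop) ≤ tr inner
    entered-loop≤tr-inner = ≤-by-cases from-state from-input
      where
      open HomReasoning
      bypass : (ι₂ ⨾ (id ⊕₁ ι₁) ⨾ inner) ≈ ((ι₁ ⨾ f) ⨾ ι₂)
      bypass = begin-equality
        ι₂ ⨾ (id ⊕₁ ι₁) ⨾ inner          ≈⟨ ≈-trans (pullˡ ι₂-⊕) assoc ⟩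
        ι₁ ⨾ ι₂ ⨾ α⊕⁻¹ ⨾ doubled ⨾ α⊕    ≈⟨ ≈-trans (pull₃ ι₁ι₂-α⊕⁻¹) assoc ⟩
        ι₂ ⨾ ι₁ ⨾ doubled ⨾ α⊕           ≈⟨ refl⟩⨾⟨ ι₁-doubled-α⊕ ⟩
        ι₂ ⨾ loop ⨾ ι₂                   ≈⟨ pullˡ (cancelˡ ι₂-∇) ⟩
        (ι₁ ⨾ f) ⨾ ι₂                    ∎
      from-state : (ι₁ ⨾ (id ⊕₁ enter) ⨾ loop) ≤ (ι₁ ⨾ tr inner)
      from-state = begin
        ι₁ ⨾ (id ⊕₁ enter) ⨾ loop   ≈⟨ ≈-trans (pullˡ ι₁-⊕) (≈-trans (identityˡ ⟩⨾⟨refl) (cancelˡ ι₁-∇)) ⟩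
        ι₁ ⨾ f                      ≤⟨ bypass≤tr (≈⇒≥ bypass) ⟩
        tr ((id ⊕₁ ι₁) ⨾ inner)     ≈⟨ tr-precompose ⟩
        ι₁ ⨾ tr inner               ∎
      delayed₁ : (ι₁ ⨾ ((ι₁ ⨾ f) ⊕₁ enter) ⨾ σ⊕) ≈ (ι₁ ⨾ (id ⊕₁ ι₂) ⨾ inner)
      delayed₁ = begin-equality
        ι₁ ⨾ ((ι₁ ⨾ f) ⊕₁ enter) ⨾ σ⊕   ≈⟨ ≈-trans (pullˡ ι₁-⊕) (≈-trans assoc (refl⟩⨾⟨ ι₁-σ⊕)) ⟩
        (ι₁ ⨾ f) ⨾ ι₂                   ≈⟨ pullˡ (cancelˡ ι₁-∇) ⟨
        ι₁ ⨾ loop ⨾ ι₂                  ≈⟨ refl⟩⨾⟨ ι₁-doubled-α⊕ ⟨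
        ι₁ ⨾ ι₁ ⨾ doubled ⨾ α⊕          ≈⟨ ≈-trans (pullˡ ι₁-α⊕⁻¹) assoc ⟨
        ι₁ ⨾ α⊕⁻¹ ⨾ doubled ⨾ α⊕        ≈⟨ ≈-trans (pullˡ ι₁-⊕) (identityˡ ⟩⨾⟨refl) ⟨
        ι₁ ⨾ (id ⊕₁ ι₂) ⨾ inner         ∎
      delayed₂ : (ι₂ ⨾ ((ι₁ ⨾ f) ⊕₁ enter) ⨾ σ⊕) ≈ (ι₂ ⨾ (id ⊕₁ ι₂) ⨾ inner)
      delayed₂ = begin-equality
        ι₂ ⨾ ((ι₁ ⨾ f) ⊕₁ enter) ⨾ σ⊕   ≈⟨ ≈-trans (pullˡ ι₂-⊕) (≈-trans assoc (refl⟩⨾⟨ ι₂-σ⊕)) ⟩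
        enter ⨾ ι₁                      ≈⟨ refl⟩⨾⟨ ι₁ι₁-α⊕ ⟨
        enter ⨾ ι₁ ⨾ ι₁ ⨾ α⊕            ≈⟨ ≈-trans (pullˡ ι₂-copair) (≈-trans assoc (refl⟩⨾⟨ assoc)) ⟨
        ι₂ ⨾ doubled ⨾ α⊕               ≈⟨ pull₃ ι₂ι₂-α⊕⁻¹ ⟨
        ι₂ ⨾ ι₂ ⨾ α⊕⁻¹ ⨾ doubled ⨾ α⊕   ≈⟨ ≈-trans (pullˡ ι₂-⊕) assoc ⟨
        ι₂ ⨾ (id ⊕₁ ι₂) ⨾ inner         ∎
      from-input : (ι₂ ⨾ (id ⊕₁ enter) ⨾ loop) ≤ (ι₂ ⨾ tr inner)
      from-input = begin
        ι₂ ⨾ (id ⊕₁ enter) ⨾ loop       ≈⟨ ≈-trans (pullˡ ι₂-⊕) (≈-trans assoc (refl⟩⨾⟨ cancelˡ ι₂-∇)) ⟩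
        enter ⨾ ι₁ ⨾ f                  ≈⟨ tr-delay ⟨
        tr (((ι₁ ⨾ f) ⊕₁ enter) ⨾ σ⊕)   ≈⟨ tr-cong (≈-by-cases delayed₁ delayed₂) ⟩
        tr ((id ⊕₁ ι₂) ⨾ inner)         ≈⟨ tr-precompose ⟩
        ι₂ ⨾ tr inner                   ∎

    enter⨾trFromState≤tr : (enter ⨾ trFromState f) ≤ tr f
    enter⨾trFromState≤tr = begin
      enter ⨾ tr loop              ≈⟨ tr-precompose ⟨
      tr ((id ⊕₁ enter) ⨾ loop)    ≤⟨ tr-mono entered-loop≤tr-inner ⟩
      tr (tr inner)                ≈⟨ tr-joining ⟨
      tr doubled                   ≤⟨ tr-doubled≤tr ⟩
      tr f                         ∎
      where open HomReasoning

  comp-ST⨾trFromState≤trFromState : (f : (S ⊕₀ X) ⇒ (S ⊕₀ Y)) →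
                                     (comp-ST f ⨾ trFromState f) ≤ trFromState f
  comp-ST⨾trFromState≤trFromState f = begin
    comp-ST f ⨾ trFromState f         ≈⟨ comp-ST≈ f ⟩⨾⟨refl ⟩
    (ι₁ ⨾ f ⨾ π₁) ⨾ tr (∇ ⨾ ι₁ ⨾ f)    ≈⟨ enter-loop ⟩⨾⟨ tr-cong (refl⟩⨾⟨ cancelˡ ι₁-∇) ⟨
    enter ⨾ trFromState loop          ≤⟨ enter⨾trFromState≤tr ⟩
    trFromState f                     ∎
    where
    open HomReasoning
    open Unfolding f using (loop)
    open Unfolding loop using (enter; enter⨾trFromState≤tr)
    enter-loop : enter ≈ (ι₁ ⨾ f ⨾ π₁)
    enter-loop = ≈-trans (refl⟩⨾⟨ ≈-trans assoc (refl⟩⨾⟨ assoc)) (cancelˡ ι₂-∇)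

  comp-SY≤trFromState : (f : (S ⊕₀ X) ⇒ (S ⊕₀ Y)) → comp-SY f ≤ trFromState f
  comp-SY≤trFromState f = bypass≤tr (begin
    comp-SY f ⨾ ι₂        ≈⟨ ≈-trans (comp-SY≈ f ⟩⨾⟨refl) (≈-trans assoc (refl⟩⨾⟨ assoc)) ⟩
    ι₁ ⨾ f ⨾ π₂ ⨾ ι₂      ≤⟨ ⨾-monoʳ (⨾-monoʳ π₂⨾ι₂≤id) ⟩
    ι₁ ⨾ f ⨾ id           ≈⟨ refl⟩⨾⟨ identityʳ ⟩
    ι₁ ⨾ f                ≈⟨ cancelˡ ι₂-∇ ⟨
    ι₂ ⨾ ∇ ⨾ ι₁ ⨾ f       ∎)
    where open HomReasoning

  comp-XT⨾trFromState≤tr : (f : (S ⊕₀ X) ⇒ (S ⊕₀ Y)) → (comp-XT f ⨾ trFromState f) ≤ tr f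
  comp-XT⨾trFromState≤tr f =
    ≤-trans (⨾-monoˡ (≈⇒≤ (comp-XT≈ f))) (Unfolding.enter⨾trFromState≤tr f)

  comp-XY≤tr : (f : (S ⊕₀ X) ⇒ (S ⊕₀ Y)) → comp-XY f ≤ tr f
  comp-XY≤tr f = bypass≤tr (begin
    comp-XY f ⨾ ι₂        ≈⟨ ≈-trans (comp-XY≈ f ⟩⨾⟨refl) (≈-trans assoc (refl⟩⨾⟨ assoc)) ⟩
    ι₂ ⨾ f ⨾ π₂ ⨾ ι₂      ≤⟨ ⨾-monoʳ (⨾-monoʳ π₂⨾ι₂≤id) ⟩
    ι₂ ⨾ f ⨾ id           ≈⟨ refl⟩⨾⟨ identityʳ ⟩
    ι₂ ⨾ f                ∎)
    where open HomReasoning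

  tr-matrix≤ : {a : S ⇒ S} {b : S ⇒ Y} {c : X ⇒ S} {d : X ⇒ Y} {u : S ⇒ Y} {z : X ⇒ Y} →
               (a ⨾ u) ≤ u → b ≤ u → (c ⨾ u) ≤ z → d ≤ z → tr (matrix a b c d) ≤ z
  tr-matrix≤ {a = a} {b} {c} {d} {u} {z} au≤u b≤u cu≤z d≤z = begin
    tr (matrix a b c d)           ≤⟨ AU1 {r = u} simulation ⟩
    tr ((id ⊕₁ z) ⨾ ∇ ⨾ Δ)        ≈⟨ tr-precompose ⟩
    z ⨾ tr (∇ ⨾ Δ)                ≤⟨ ⨾-monoʳ AT1 ⟩
    z ⨾ id                        ≈⟨ identityʳ ⟩
    z                             ∎
    where
    open HomReasoning
    simulation : (matrix a b c d ⨾ (u ⊕₁ id)) ≤ ((u ⊕₁ id) ⨾ (id ⊕₁ z) ⨾ ∇ ⨾ Δ)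
    simulation = begin
      ((Δ ⊕₁ Δ) ⨾ ((a ⊕₁ b) ⊕₁ (c ⊕₁ d)) ⨾ shuffle ⨾ (∇ ⊕₁ ∇)) ⨾ (u ⊕₁ id)
        ≈⟨ ≈-trans assoc (refl⟩⨾⟨ ≈-trans assoc (refl⟩⨾⟨ assoc)) ⟩
      (Δ ⊕₁ Δ) ⨾ ((a ⊕₁ b) ⊕₁ (c ⊕₁ d)) ⨾ shuffle ⨾ (∇ ⊕₁ ∇) ⨾ (u ⊕₁ id)
        ≈⟨ refl⟩⨾⟨ refl⟩⨾⟨ refl⟩⨾⟨ ≈-trans ⊕-⨾ (≈-trans (∇-nat ⟩⊕⟨ ∇-nat) ⊕.●-hom) ⟩
      (Δ ⊕₁ Δ) ⨾ ((a ⊕₁ b) ⊕₁ (c ⊕₁ d)) ⨾ shuffle ⨾ ((u ⊕₁ u) ⊕₁ (id ⊕₁ id)) ⨾ (∇ ⊕₁ ∇)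
        ≈⟨ refl⟩⨾⟨ refl⟩⨾⟨ pullˡ (≈-sym shuffle-nat) ⟩
      (Δ ⊕₁ Δ) ⨾ ((a ⊕₁ b) ⊕₁ (c ⊕₁ d)) ⨾ (((u ⊕₁ id) ⊕₁ (u ⊕₁ id)) ⨾ shuffle) ⨾ (∇ ⊕₁ ∇)
        ≈⟨ refl⟩⨾⟨ ≈-trans (refl⟩⨾⟨ assoc) (pullˡ (≈-trans ⊕-⨾ (⊕-⨾ ⟩⊕⟨ ⊕-⨾))) ⟩
      (Δ ⊕₁ Δ) ⨾ (((a ⨾ u) ⊕₁ (b ⨾ id)) ⊕₁ ((c ⨾ u) ⊕₁ (d ⨾ id))) ⨾ shuffle ⨾ (∇ ⊕₁ ∇)
        ≤⟨ ⨾-monoʳ (⨾-monoˡ (⊕.●-mono (⊕.●-mono au≤u bu≤u) (⊕.●-mono cu≤z dz≤z))) ⟩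
      (Δ ⊕₁ Δ) ⨾ ((u ⊕₁ u) ⊕₁ (z ⊕₁ z)) ⨾ shuffle ⨾ (∇ ⊕₁ ∇)
        ≈⟨ pullˡ (≈-trans ⊕-⨾ (≈-trans (≈-sym Δ-nat ⟩⊕⟨ ≈-sym Δ-nat) ⊕.●-hom)) ⟩
      ((u ⊕₁ z) ⨾ (Δ ⊕₁ Δ)) ⨾ shuffle ⨾ (∇ ⊕₁ ∇)
        ≈⟨ ≈-trans assoc (refl⟩⨾⟨ pullˡ (≈-sym Δ-⊕)) ⟩
      (u ⊕₁ z) ⨾ Δ ⨾ (∇ ⊕₁ ∇)
        ≈⟨ refl⟩⨾⟨ Δ-nat ⟨
      (u ⊕₁ z) ⨾ ∇ ⨾ Δ
        ≈⟨ ≈-trans (⊕-split ⟩⨾⟨refl) assoc ⟩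
      (u ⊕₁ id) ⨾ (id ⊕₁ z) ⨾ ∇ ⨾ Δ ∎
      where
      bu≤u : (b ⨾ id) ≤ u
      bu≤u = ≤-trans (≈⇒≤ identityʳ) b≤u
      dz≤z : (d ⨾ id) ≤ z
      dz≤z = ≤-trans (≈⇒≤ identityʳ) d≤z

  ⊗-⨾-mono : {f : A ⇒ B} {g : B ⇒ C} {k : A ⇒ C} {f′ : A′ ⇒ B′} {g′ : B′ ⇒ C′} {k′ : A′ ⇒ C′} →
             (f ⨾ g) ≤ k → (f′ ⨾ g′) ≤ k′ → ((f ⊗₁ f′) ⨾ (g ⊗₁ g′)) ≤ (k ⊗₁ k′)
  ⊗-⨾-mono fg≤k f′g′≤k′ = ≤-trans (≈⇒≥ ⊗.●-hom) (⊗.●-mono fg≤k f′g′≤k′)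

proposition7p4 : ∀ {o h r : Level} (K : KleeneRigCategory o h r) →
    let open KleeneRigCategory K
        open Matrix K
    in ∀ {S X Y S′ X′ Y′}
       (f : (S ⊕₀ X) ⇒ (S ⊕₀ Y)) (f′ : (S′ ⊕₀ X′) ⇒ (S′ ⊕₀ Y′)) →
       tr {S ⊗₀ S′}
          (matrix (comp-ST f ⊗₁ comp-ST f′) (comp-SY f ⊗₁ comp-SY f′)
                  (comp-XT f ⊗₁ comp-XT f′) (comp-XY f ⊗₁ comp-XY f′))
       ≤ (tr f ⊗₁ tr f′)
proposition7p4 K f f′ =
  tr-matrix≤ (⊗-⨾-mono (comp-ST⨾trFromState≤trFromState f) (comp-ST⨾trFromState≤trFromState f′))
             (⊗.●-mono (comp-SY≤trFromState f) (comp-SY≤trFromState f′))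
             (⊗-⨾-mono (comp-XT⨾trFromState≤tr f) (comp-XT⨾trFromState≤tr f′))
             (⊗.●-mono (comp-XY≤tr f) (comp-XY≤tr f′))
  where open KleeneRigProperties K
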